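{- Let $G$ and $H$ be hypergraphs. If $G\cong_f H$, then $p_f(G)=p_f(H)$, $\mu_f(G)=\mu_f(H)$, and $\tau_f(G)=\tau_f(H)$.
   Context: A hypergraph $G=(V,X)$ consists of a finite vertex set $V$ and a family $X$ of subsets of $V$ (hyperedges). If $G$ has $n$ vertices and $m\ge1$ hyperedges, its vertex-hyperedge incidence matrix $M_G\in\{0,1\}^{n\times m}$ has $(i,j)$ entry $1$ iff vertex $i$ belongs to hyperedge $j$. The dual hypergraph $G^*$ has incidence matrix $M_G^t$. A doubly stochastic matrix is a square nonnegative matrix whose rows and columns each sum to $1$. $G\cong_f H$ means: either $G$ and $H$ have the same number of vertices and no hyperedges, or there exist doubly stochastic matrices $S_1,S_2$ with $S_1M_G=M_HS_2^t$ and $M_GS_2=S_1^tM_H$. The fractional covering number $k_f(G)$ is the optimum of "minimize $\mathbf{1}^tx$ s.t. $M_Gx\ge\mathbf{1}$, $x\ge0$" ($\infty$ if infeasible); the fractional packing number $p_f(G)$ is the optimum of "maximize $\mathbf{1}^ty$ s.t. $M_G^ty\le\mathbf{1}$, $y\ge0$" ($\infty$ if unbounded). The fractional matching number is $\mu_f(G)=p_f(G^*)$ and the fractional transversal number is $\tau_f(G)=k_f(G^*)$.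
   Formalization: The doubly stochastic matrices $S_1,S_2$ have rational entries, and the variables of the linear programs defining $p_f$ and $k_f$, hence $\mu_f$ and $\tau_f$, are rational. -}

module Defs where

open import Data.Nat using (ℕ; zero; suc) renaming (_≤_ to _≤ℕ_)
open import Data.Fin using (Fin; zero; suc)
open import Data.Bool using (Bool; true; false; if_then_else_)
open import Data.Rational using (ℚ; 0ℚ; 1ℚ; _+_; _*_; _≤_; _<_)
open import Data.Product using (Σ; ∃; _×_; _,_)
open import Data.Sum using (_⊎_)
open import Relation.Binary.PropositionalEquality using (_≡_)
open import Relation.Nullary using (¬_)

sumFin : (n : ℕ) → (Fin n → ℚ) → ℚ
sumFin zero    f = 0ℚ
sumFin (suc n) f = f zero + sumFin n (λ i → f (suc i))

Mat : ℕ → ℕ → Set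
Mat r c = Fin r → Fin c → ℚ

_⊗_ : {r k c : ℕ} → Mat r k → Mat k c → Mat r c
_⊗_ {k = k} A B i j = sumFin k (λ l → A i l * B l j)

transpose : {r c : ℕ} → Mat r c → Mat c r
transpose A i j = A j i

-- Hypergraph: n vertices, m hyperedges (a family, repetitions allowed),
-- given by its 0/1 vertex-hyperedge incidence relation.
record Hypergraph : Set where
  field
    nV  : ℕ
    nE  : ℕ
    inc : Fin nV → Fin nE → Bool
open Hypergraph public

incMat : (G : Hypergraph) → Mat (nV G) (nE G)
incMat G i j = if inc G i j then 1ℚ else 0ℚ

dual : Hypergraph → Hypergraph
dual G = record { nV = nE G ; nE = nV G ; inc = λ j i → inc G i j }

DoublyStochastic : {r c : ℕ} → Mat r c → Set
DoublyStochastic {r} {c} S =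
  (r ≡ c)
  × (∀ i j → 0ℚ ≤ S i j)
  × (∀ i → sumFin c (λ j → S i j) ≡ 1ℚ)
  × (∀ j → sumFin r (λ i → S i j) ≡ 1ℚ)

FracIso : Hypergraph → Hypergraph → Set
FracIso G H =
  (nV G ≡ nV H × nE G ≡ 0 × nE H ≡ 0)
  ⊎ (1 ≤ℕ nE G × 1 ≤ℕ nE H ×
     Σ (Mat (nV H) (nV G)) λ S₁ → Σ (Mat (nE G) (nE H)) λ S₂ →
       DoublyStochastic S₁ × DoublyStochastic S₂
       × (S₁ ⊗ incMat G ≡ incMat H ⊗ transpose S₂)
       × (incMat G ⊗ S₂ ≡ transpose S₁ ⊗ incMat H))

data ℚ∞ : Set where
  fin : ℚ → ℚ∞
  ∞   : ℚ∞

PackFeasible : (G : Hypergraph) → (Fin (nV G) → ℚ) → Set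
PackFeasible G y =
  (∀ i → 0ℚ ≤ y i)
  × (∀ j → sumFin (nV G) (λ i → incMat G i j * y i) ≤ 1ℚ)

IsPf : Hypergraph → ℚ∞ → Set
IsPf G (fin q) =
  (Σ (Fin (nV G) → ℚ) λ y → PackFeasible G y × sumFin (nV G) y ≡ q)
  × (∀ y → PackFeasible G y → sumFin (nV G) y ≤ q)
IsPf G ∞ = ∀ q → Σ (Fin (nV G) → ℚ) λ y → PackFeasible G y × q < sumFin (nV G) y

CoverFeasible : (G : Hypergraph) → (Fin (nE G) → ℚ) → Set
CoverFeasible G x =
  (∀ j → 0ℚ ≤ x j)
  × (∀ i → 1ℚ ≤ sumFin (nE G) (λ j → incMat G i j * x j))

IsKf : Hypergraph → ℚ∞ → Set
IsKf G (fin q) =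
  (Σ (Fin (nE G) → ℚ) λ x → CoverFeasible G x × sumFin (nE G) x ≡ q)
  × (∀ x → CoverFeasible G x → q ≤ sumFin (nE G) x)
IsKf G ∞ = ¬ (Σ (Fin (nE G) → ℚ) λ x → CoverFeasible G x)

IsMuf : Hypergraph → ℚ∞ → Set
IsMuf G = IsPf (dual G)

IsTauf : Hypergraph → ℚ∞ → Set
IsTauf G = IsKf (dual G)

-- A fractional isomorphism (S₁, S₂) sends a fractional packing y of G to S₁ y:
-- column-stochasticity of S₁ preserves the total weight, and the intertwining
-- relation M_G S₂ = S₁ᵗ M_H turns the constraint vector M_Hᵗ (S₁ y) into
-- S₂ᵗ (M_Gᵗ y), whose entries are convex combinations of those of M_Gᵗ y and
-- so obey the same bound. The same map works for coverings by the dual, the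
-- data (S₁ᵗ, S₂ᵗ) give the way back, and (S₂ᵗ, S₁ᵗ) is a fractional isomorphism
-- of the dual hypergraphs. Feasible sets thus correspond in both directions
-- with equal objective values, so the optima agree.
module Submission where

open import Algebra.Bundles using (Ring)
open import Data.Fin using (Fin; zero; suc)
open import Data.Nat using (ℕ; zero; suc)
open import Data.Product using (Σ; _×_; _,_; proj₁; proj₂)
open import Data.Rational using (ℚ; 0ℚ; 1ℚ; _+_; _*_; _≤_; _<_; nonNegative)
open import Data.Rational.Properties
  using ( +-*-ring; +-identityˡ; +-identityʳ; +-mono-≤; *-comm; *-assoc
        ; *-identityˡ; *-monoˡ-≤-nonNeg; nonNeg*nonNeg⇒nonNeg; nonNegative⁻¹
        ; ≤-refl; module ≤-Reasoning)
open import Data.Sum using (inj₁; inj₂)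
open import Data.Vec.Functional using (Vector)
open import Function.Bundles using (_⇔_; mk⇔)
open import Relation.Binary.PropositionalEquality
  using (_≡_; _≗_; refl; sym; trans; cong; cong₂; cong-app; subst; module ≡-Reasoning)
open import Relation.Nullary using (¬_)

open import Algebra.Properties.Semiring.Sum (Ring.semiring +-*-ring)
  using (sum; ∑-comm; *-distribˡ-sum; *-distribʳ-sum; sum-replicate-zero)

open import Defs

sumFin-cong : ∀ n {f g : Vector ℚ n} → f ≗ g → sumFin n f ≡ sumFin n g
sumFin-cong zero    f≗g = refl
sumFin-cong (suc n) f≗g = cong₂ _+_ (f≗g zero) (sumFin-cong n (λ i → f≗g (suc i)))

sumFin≡sum : ∀ n (f : Vector ℚ n) → sumFin n f ≡ sum f
sumFin≡sum zero    f = refl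
sumFin≡sum (suc n) f = cong (f zero +_) (sumFin≡sum n (λ i → f (suc i)))

sumFin-zero : ∀ n → sumFin n (λ _ → 0ℚ) ≡ 0ℚ
sumFin-zero n = trans (sumFin≡sum n _) (sum-replicate-zero n)

sumFin-*ˡ : ∀ n c (f : Vector ℚ n) → sumFin n (λ i → c * f i) ≡ c * sumFin n f
sumFin-*ˡ n c f = begin
  sumFin n (λ i → c * f i) ≡⟨ sumFin≡sum n _ ⟩
  sum (λ i → c * f i)      ≡⟨ *-distribˡ-sum c f ⟨
  c * sum f                ≡⟨ cong (c *_) (sumFin≡sum n f) ⟨
  c * sumFin n f           ∎
  where open ≡-Reasoning

sumFin-*ʳ : ∀ n c (f : Vector ℚ n) → sumFin n (λ i → f i * c) ≡ sumFin n f * c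
sumFin-*ʳ n c f = begin
  sumFin n (λ i → f i * c) ≡⟨ sumFin≡sum n _ ⟩
  sum (λ i → f i * c)      ≡⟨ *-distribʳ-sum c f ⟨
  sum f * c                ≡⟨ cong (_* c) (sumFin≡sum n f) ⟨
  sumFin n f * c           ∎
  where open ≡-Reasoning

sumFin-comm : ∀ m n (f : Fin m → Fin n → ℚ) →
  sumFin m (λ i → sumFin n (f i)) ≡ sumFin n (λ j → sumFin m (λ i → f i j))
sumFin-comm m n f = begin
  sumFin m (λ i → sumFin n (f i))          ≡⟨ sumFin²≡sum² m n f ⟩
  sum (λ i → sum (f i))                    ≡⟨ ∑-comm f ⟩
  sum (λ j → sum (λ i → f i j))            ≡⟨ sumFin²≡sum² n m (λ j i → f i j) ⟨
  sumFin n (λ j → sumFin m (λ i → f i j))  ∎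
  where
  open ≡-Reasoning
  sumFin²≡sum² : ∀ m n (g : Fin m → Fin n → ℚ) →
    sumFin m (λ i → sumFin n (g i)) ≡ sum (λ i → sum (g i))
  sumFin²≡sum² m n g =
    trans (sumFin-cong m (λ i → sumFin≡sum n (g i))) (sumFin≡sum m _)

sumFin-mono-≤ : ∀ n {f g : Vector ℚ n} → (∀ i → f i ≤ g i) → sumFin n f ≤ sumFin n g
sumFin-mono-≤ zero    f≤g = ≤-refl
sumFin-mono-≤ (suc n) f≤g = +-mono-≤ (f≤g zero) (sumFin-mono-≤ n (λ i → f≤g (suc i)))

*-nonNeg : ∀ {p q} → 0ℚ ≤ p → 0ℚ ≤ q → 0ℚ ≤ p * q
*-nonNeg {p} {q} 0≤p 0≤q =
  nonNegative⁻¹ (p * q) {{nonNeg*nonNeg⇒nonNeg p {{nonNegative 0≤p}} q {{nonNegative 0≤q}}}}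

convexCombination-const : ∀ n {w : Vector ℚ n} c → sumFin n w ≡ 1ℚ →
  sumFin n (λ l → w l * c) ≡ c
convexCombination-const n {w} c ∑w≡1 = begin
  sumFin n (λ l → w l * c) ≡⟨ sumFin-*ʳ n c w ⟩
  sumFin n w * c           ≡⟨ cong (_* c) ∑w≡1 ⟩
  1ℚ * c                   ≡⟨ *-identityˡ c ⟩
  c                        ∎
  where open ≡-Reasoning

convexCombination-≤ : ∀ n {w z : Vector ℚ n} {c} → (∀ l → 0ℚ ≤ w l) →
  sumFin n w ≡ 1ℚ → (∀ l → z l ≤ c) → sumFin n (λ l → w l * z l) ≤ c
convexCombination-≤ n {w} {z} {c} w≥0 ∑w≡1 z≤c = begin
  sumFin n (λ l → w l * z l) ≤⟨ sumFin-mono-≤ n (λ l → *-monoˡ-≤-nonNeg (w l) {{nonNegative (w≥0 l)}} (z≤c l)) ⟩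
  sumFin n (λ l → w l * c)   ≡⟨ convexCombination-const n c ∑w≡1 ⟩
  c                          ∎
  where open ≤-Reasoning

convexCombination-≥ : ∀ n {w z : Vector ℚ n} {c} → (∀ l → 0ℚ ≤ w l) →
  sumFin n w ≡ 1ℚ → (∀ l → c ≤ z l) → c ≤ sumFin n (λ l → w l * z l)
convexCombination-≥ n {w} {z} {c} w≥0 ∑w≡1 c≤z = begin
  c                          ≡⟨ convexCombination-const n c ∑w≡1 ⟨
  sumFin n (λ l → w l * c)   ≤⟨ sumFin-mono-≤ n (λ l → *-monoˡ-≤-nonNeg (w l) {{nonNegative (w≥0 l)}} (c≤z l)) ⟩
  sumFin n (λ l → w l * z l) ∎
  where open ≤-Reasoning

infix 4 _≐_
_≐_ : ∀ {r c} → Mat r c → Mat r c → Set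
M ≐ N = ∀ i j → M i j ≡ N i j

infixr 7 _·_
_·_ : ∀ {r c} → Mat r c → Vector ℚ c → Vector ℚ r
_·_ {c = c} M y k = sumFin c (λ i → M k i * y i)

·-congˡ : ∀ {r c} {M N : Mat r c} → M ≐ N → ∀ y → M · y ≗ N · y
·-congˡ {c = c} M≐N y k = sumFin-cong c (λ i → cong (_* y i) (M≐N k i))

·-assoc : ∀ {r k c} (M : Mat r k) (N : Mat k c) (y : Vector ℚ c) → M · (N · y) ≗ (M ⊗ N) · y
·-assoc {k = k} {c} M N y i = begin
  sumFin k (λ l → M i l * sumFin c (λ j → N l j * y j))   ≡⟨ sumFin-cong k (λ l → sumFin-*ˡ c (M i l) _) ⟨
  sumFin k (λ l → sumFin c (λ j → M i l * (N l j * y j))) ≡⟨ sumFin-comm k c _ ⟩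
  sumFin c (λ j → sumFin k (λ l → M i l * (N l j * y j))) ≡⟨ sumFin-cong c (λ j → sumFin-cong k (λ l → *-assoc (M i l) (N l j) (y j))) ⟨
  sumFin c (λ j → sumFin k (λ l → M i l * N l j * y j))   ≡⟨ sumFin-cong c (λ j → sumFin-*ʳ k (y j) _) ⟩
  sumFin c (λ j → (M ⊗ N) i j * y j)                      ∎
  where open ≡-Reasoning

transpose-⊗ : ∀ {r k c} (M : Mat r k) (N : Mat k c) → transpose (M ⊗ N) ≐ transpose N ⊗ transpose M
transpose-⊗ {k = k} M N i j = sumFin-cong k (λ l → *-comm (M j l) (N l i))

·-nonNeg : ∀ {r c} {M : Mat r c} {y : Vector ℚ c} → (∀ k i → 0ℚ ≤ M k i) → (∀ i → 0ℚ ≤ y i) →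
  ∀ k → 0ℚ ≤ (M · y) k
·-nonNeg {c = c} {M} {y} M≥0 y≥0 k = begin
  0ℚ                        ≡⟨ sumFin-zero c ⟨
  sumFin c (λ _ → 0ℚ)       ≤⟨ sumFin-mono-≤ c (λ i → *-nonNeg (M≥0 k i) (y≥0 i)) ⟩
  (M · y) k                 ∎
  where open ≤-Reasoning

sumFin-·-columnStochastic : ∀ {r c} (S : Mat r c) → (∀ i → sumFin r (λ k → S k i) ≡ 1ℚ) →
  ∀ y → sumFin r (S · y) ≡ sumFin c y
sumFin-·-columnStochastic {r} {c} S columns y = begin
  sumFin r (λ k → sumFin c (λ i → S k i * y i)) ≡⟨ sumFin-comm r c _ ⟩
  sumFin c (λ i → sumFin r (λ k → S k i * y i)) ≡⟨ sumFin-cong c (λ i → convexCombination-const r (y i) (columns i)) ⟩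
  sumFin c y                                    ∎
  where open ≡-Reasoning

module _ {r c : ℕ} {S : Mat r c} (S-ds : DoublyStochastic S) where

  doublyStochastic-nonNeg : ∀ i j → 0ℚ ≤ S i j
  doublyStochastic-nonNeg = proj₁ (proj₂ S-ds)

  doublyStochastic-columnSum : ∀ j → sumFin r (λ i → S i j) ≡ 1ℚ
  doublyStochastic-columnSum = proj₂ (proj₂ (proj₂ S-ds))

  transpose-doublyStochastic : DoublyStochastic (transpose S)
  transpose-doublyStochastic =
    sym (proj₁ S-ds) , (λ i j → doublyStochastic-nonNeg j i) ,
    doublyStochastic-columnSum , proj₁ (proj₂ (proj₂ S-ds))

identityMatrix : ∀ {n} → Mat n n
identityMatrix zero    zero    = 1ℚ
identityMatrix zero    (suc _) = 0ℚ
identityMatrix (suc _) zero    = 0ℚ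
identityMatrix (suc i) (suc j) = identityMatrix i j

identityMatrix-nonNeg : ∀ {n} (i j : Fin n) → 0ℚ ≤ identityMatrix i j
identityMatrix-nonNeg zero    zero    = nonNegative⁻¹ 1ℚ
identityMatrix-nonNeg zero    (suc _) = ≤-refl
identityMatrix-nonNeg (suc _) zero    = ≤-refl
identityMatrix-nonNeg (suc i) (suc j) = identityMatrix-nonNeg i j

identityMatrix-sym : ∀ {n} → identityMatrix {n} ≐ transpose identityMatrix
identityMatrix-sym zero    zero    = refl
identityMatrix-sym zero    (suc _) = refl
identityMatrix-sym (suc _) zero    = refl
identityMatrix-sym (suc i) (suc j) = identityMatrix-sym i j

identityMatrix-rowSum : ∀ n (i : Fin n) → sumFin n (identityMatrix i) ≡ 1ℚ
identityMatrix-rowSum (suc n) zero =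
  trans (cong (1ℚ +_) (sumFin-zero n)) (+-identityʳ 1ℚ)
identityMatrix-rowSum (suc n) (suc i) =
  trans (+-identityˡ _) (identityMatrix-rowSum n i)

identityMatrix-doublyStochastic : ∀ n → DoublyStochastic (identityMatrix {n})
identityMatrix-doublyStochastic n =
  refl , identityMatrix-nonNeg , identityMatrix-rowSum n ,
  λ j → trans (sumFin-cong n (λ i → identityMatrix-sym i j)) (identityMatrix-rowSum n j)

record SumPreservingMap {m n : ℕ} (F : Vector ℚ m → Set) (F′ : Vector ℚ n → Set) : Set where
  field
    apply          : Vector ℚ m → Vector ℚ n
    apply-feasible : ∀ {y} → F y → F′ (apply y)
    sumFin-apply   : ∀ y → sumFin n (apply y) ≡ sumFin m y

module _ {n : ℕ} (F : Vector ℚ n → Set) where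

  IsMaximum : ℚ → Set
  IsMaximum q = (Σ (Vector ℚ n) λ y → F y × sumFin n y ≡ q) × (∀ y → F y → sumFin n y ≤ q)

  Unbounded : Set
  Unbounded = ∀ q → Σ (Vector ℚ n) λ y → F y × q < sumFin n y

  IsMinimum : ℚ → Set
  IsMinimum q = (Σ (Vector ℚ n) λ y → F y × sumFin n y ≡ q) × (∀ y → F y → q ≤ sumFin n y)

  Infeasible : Set
  Infeasible = ¬ Σ (Vector ℚ n) F

module _ {m n : ℕ} {F : Vector ℚ m → Set} {F′ : Vector ℚ n → Set} where
  open SumPreservingMap

  isMaximum-transport : SumPreservingMap F F′ → SumPreservingMap F′ F →
                        ∀ {q} → IsMaximum F q → IsMaximum F′ q
  isMaximum-transport φ ψ ((y , Fy , ∑y≡q) , ∑≤q) =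
    (apply φ y , apply-feasible φ Fy , trans (sumFin-apply φ y) ∑y≡q) ,
    λ y′ F′y′ → subst (_≤ _) (sumFin-apply ψ y′) (∑≤q (apply ψ y′) (apply-feasible ψ F′y′))

  isMinimum-transport : SumPreservingMap F F′ → SumPreservingMap F′ F →
                        ∀ {q} → IsMinimum F q → IsMinimum F′ q
  isMinimum-transport φ ψ ((y , Fy , ∑y≡q) , q≤∑) =
    (apply φ y , apply-feasible φ Fy , trans (sumFin-apply φ y) ∑y≡q) ,
    λ y′ F′y′ → subst (_ ≤_) (sumFin-apply ψ y′) (q≤∑ (apply ψ y′) (apply-feasible ψ F′y′))

  unbounded-transport : SumPreservingMap F F′ → Unbounded F → Unbounded F′
  unbounded-transport φ unbounded q with unbounded q
  ... | y , Fy , q<∑y = apply φ y , apply-feasible φ Fy , subst (q <_) (sym (sumFin-apply φ y)) q<∑y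

  infeasible-transport : SumPreservingMap F′ F → Infeasible F → Infeasible F′
  infeasible-transport ψ infeasible (y′ , F′y′) = infeasible (apply ψ y′ , apply-feasible ψ F′y′)

module _ {m n : ℕ} {F : Vector ℚ m → Set} {F′ : Vector ℚ n → Set}
         (φ : SumPreservingMap F F′) (ψ : SumPreservingMap F′ F) where

  isMaximum-⇔ : ∀ {q} → IsMaximum F q ⇔ IsMaximum F′ q
  isMaximum-⇔ = mk⇔ (isMaximum-transport φ ψ) (isMaximum-transport ψ φ)

  unbounded-⇔ : Unbounded F ⇔ Unbounded F′
  unbounded-⇔ = mk⇔ (unbounded-transport φ) (unbounded-transport ψ)

  isMinimum-⇔ : ∀ {q} → IsMinimum F q ⇔ IsMinimum F′ q
  isMinimum-⇔ = mk⇔ (isMinimum-transport φ ψ) (isMinimum-transport ψ φ)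

  infeasible-⇔ : Infeasible F ⇔ Infeasible F′
  infeasible-⇔ = mk⇔ (infeasible-transport ψ) (infeasible-transport φ)

-- IsPf G and IsTauf G unfold to IsMaximum/Unbounded of Packing (incMat G) and
-- IsMinimum/Infeasible of Covering (transpose (incMat G)).
Packing : ∀ {a b} → Mat a b → Vector ℚ a → Set
Packing M y = (∀ i → 0ℚ ≤ y i) × (∀ j → (transpose M · y) j ≤ 1ℚ)

Covering : ∀ {a b} → Mat a b → Vector ℚ b → Set
Covering M x = (∀ j → 0ℚ ≤ x j) × (∀ i → 1ℚ ≤ (M · x) i)

record FractionalIso {a b a′ b′ : ℕ} (A : Mat a b) (B : Mat a′ b′) : Set where
  field
    S₁ : Mat a′ a
    S₂ : Mat b b′
    S₁-doublyStochastic : DoublyStochastic S₁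
    S₂-doublyStochastic : DoublyStochastic S₂
    S₁A≐BS₂ᵗ : S₁ ⊗ A ≐ B ⊗ transpose S₂
    AS₂≐S₁ᵗB : A ⊗ S₂ ≐ transpose S₁ ⊗ B

module _ {a b a′ b′ : ℕ} {A : Mat a b} {B : Mat a′ b′} (iso : FractionalIso A B) where
  open FractionalIso iso

  fractionalIso-sym : FractionalIso B A
  fractionalIso-sym = record
    { S₁ = transpose S₁
    ; S₂ = transpose S₂
    ; S₁-doublyStochastic = transpose-doublyStochastic S₁-doublyStochastic
    ; S₂-doublyStochastic = transpose-doublyStochastic S₂-doublyStochastic
    ; S₁A≐BS₂ᵗ = λ i j → sym (AS₂≐S₁ᵗB i j)
    ; AS₂≐S₁ᵗB = λ i j → sym (S₁A≐BS₂ᵗ i j)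
    }

  fractionalIso-transpose : FractionalIso (transpose A) (transpose B)
  fractionalIso-transpose = record
    { S₁ = transpose S₂
    ; S₂ = transpose S₁
    ; S₁-doublyStochastic = transpose-doublyStochastic S₂-doublyStochastic
    ; S₂-doublyStochastic = transpose-doublyStochastic S₁-doublyStochastic
    ; S₁A≐BS₂ᵗ = λ i j → trans (sym (transpose-⊗ A S₂ i j))
                           (trans (AS₂≐S₁ᵗB j i) (transpose-⊗ (transpose S₁) B i j))
    ; AS₂≐S₁ᵗB = λ i j → trans (sym (transpose-⊗ S₁ A i j))
                           (trans (S₁A≐BS₂ᵗ j i) (transpose-⊗ B (transpose S₂) i j))
    }

  constraints-intertwine : ∀ y → transpose B · (S₁ · y) ≗ transpose S₂ · (transpose A · y)
  constraints-intertwine y j = begin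
    (transpose B · (S₁ · y)) j            ≡⟨ ·-assoc (transpose B) S₁ y j ⟩
    ((transpose B ⊗ S₁) · y) j            ≡⟨ ·-congˡ BᵗS₁≐S₂ᵗAᵗ y j ⟩
    ((transpose S₂ ⊗ transpose A) · y) j  ≡⟨ ·-assoc (transpose S₂) (transpose A) y j ⟨
    (transpose S₂ · (transpose A · y)) j  ∎
    where
    open ≡-Reasoning
    BᵗS₁≐S₂ᵗAᵗ : transpose B ⊗ S₁ ≐ transpose S₂ ⊗ transpose A
    BᵗS₁≐S₂ᵗAᵗ i j = trans (sym (transpose-⊗ (transpose S₁) B i j))
                       (trans (sym (AS₂≐S₁ᵗB j i)) (transpose-⊗ A S₂ i j))

module _ {a b a′ b′ : ℕ} {A : Mat a b} {B : Mat a′ b′} (iso : FractionalIso A B) where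
  open FractionalIso iso

  private
    S₁≥0 : ∀ k i → 0ℚ ≤ S₁ k i
    S₁≥0 = doublyStochastic-nonNeg S₁-doublyStochastic

    S₂≥0 : ∀ l j → 0ℚ ≤ S₂ l j
    S₂≥0 = doublyStochastic-nonNeg S₂-doublyStochastic

    S₂-columnSum : ∀ j → sumFin b (λ l → S₂ l j) ≡ 1ℚ
    S₂-columnSum = doublyStochastic-columnSum S₂-doublyStochastic

    sumFin-S₁· : ∀ y → sumFin a′ (S₁ · y) ≡ sumFin a y
    sumFin-S₁· = sumFin-·-columnStochastic S₁ (doublyStochastic-columnSum S₁-doublyStochastic)

  packingMap : SumPreservingMap (Packing A) (Packing B)
  packingMap = record
    { apply          = S₁ ·_
    ; apply-feasible = λ {y} (y≥0 , Aᵗy≤1) → ·-nonNeg S₁≥0 y≥0 , λ j →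
        subst (_≤ 1ℚ) (sym (constraints-intertwine iso y j))
          (convexCombination-≤ b (λ l → S₂≥0 l j) (S₂-columnSum j) Aᵗy≤1)
    ; sumFin-apply   = sumFin-S₁·
    }

  coveringMap : SumPreservingMap (Covering (transpose A)) (Covering (transpose B))
  coveringMap = record
    { apply          = S₁ ·_
    ; apply-feasible = λ {x} (x≥0 , Aᵗx≥1) → ·-nonNeg S₁≥0 x≥0 , λ j →
        subst (1ℚ ≤_) (sym (constraints-intertwine iso x j))
          (convexCombination-≥ b (λ l → S₂≥0 l j) (S₂-columnSum j) Aᵗx≥1)
    ; sumFin-apply   = sumFin-S₁·
    }

isPf-⇔ : ∀ G H → FractionalIso (incMat G) (incMat H) → ∀ v → IsPf G v ⇔ IsPf H v
isPf-⇔ G H iso (fin q) = isMaximum-⇔ (packingMap iso) (packingMap (fractionalIso-sym iso))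
isPf-⇔ G H iso ∞       = unbounded-⇔ (packingMap iso) (packingMap (fractionalIso-sym iso))

isTauf-⇔ : ∀ G H → FractionalIso (incMat G) (incMat H) → ∀ v → IsTauf G v ⇔ IsTauf H v
isTauf-⇔ G H iso (fin q) = isMinimum-⇔ (coveringMap iso) (coveringMap (fractionalIso-sym iso))
isTauf-⇔ G H iso ∞       = infeasible-⇔ (coveringMap iso) (coveringMap (fractionalIso-sym iso))

fractionalIso-noColumns : ∀ {a b b′} (A : Mat a b) (B : Mat a b′) → b ≡ 0 → b′ ≡ 0 → FractionalIso A B
fractionalIso-noColumns {a} A B refl refl = record
  { S₁ = identityMatrix
  ; S₂ = λ ()
  ; S₁-doublyStochastic = identityMatrix-doublyStochastic a
  ; S₂-doublyStochastic = refl , (λ ()) , (λ ()) , (λ ())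
  ; S₁A≐BS₂ᵗ = λ _ ()
  ; AS₂≐S₁ᵗB = λ _ ()
  }

fracIso⇒fractionalIso : ∀ G H → FracIso G H → FractionalIso (incMat G) (incMat H)
fracIso⇒fractionalIso G H (inj₁ (refl , nE≡0 , nE′≡0)) = fractionalIso-noColumns (incMat G) (incMat H) nE≡0 nE′≡0
fracIso⇒fractionalIso G H (inj₂ (_ , _ , S₁ , S₂ , S₁-ds , S₂-ds , S₁M≡MS₂ᵗ , MS₂≡S₁ᵗM)) = record
  { S₁ = S₁
  ; S₂ = S₂
  ; S₁-doublyStochastic = S₁-ds
  ; S₂-doublyStochastic = S₂-ds
  ; S₁A≐BS₂ᵗ = λ i j → cong-app (cong-app S₁M≡MS₂ᵗ i) j
  ; AS₂≐S₁ᵗB = λ i j → cong-app (cong-app MS₂≡S₁ᵗM i) j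
  }

mainTheorem13 : (G H : Hypergraph) → FracIso G H →
    (∀ v → IsPf G v ⇔ IsPf H v)
    × (∀ v → IsMuf G v ⇔ IsMuf H v)
    × (∀ v → IsTauf G v ⇔ IsTauf H v)
mainTheorem13 G H G≅H =
  isPf-⇔ G H iso , isPf-⇔ (dual G) (dual H) (fractionalIso-transpose iso) , isTauf-⇔ G H iso
  where
  iso : FractionalIso (incMat G) (incMat H)
  iso = fracIso⇒fractionalIso G H G≅H
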